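{- Let $\Gamma$ be a finite undirected multigraph (self-loops and parallel edges allowed) with vertex set $V$ and edge set $E$, fix a vertex $v\in V$, and let $G\subseteq E$. Let $\mathcal{A}=\{F\subseteq E\mid G\not\subseteq\operatorname{Shade}F\}$. Then the simplicial complex $\mathcal{A}$ is collapsible.
   Context: For $F\subseteq E$, an $F$-path is a path of $\Gamma$ all of whose edges belong to $F$ (an edgeless path is allowed). $F$ infects an edge $e$ if there is an $F$-path from $v$ to some endpoint of $e$; $\operatorname{Shade}F=\{e\in E\mid F\text{ infects }e\}$. A simplicial complex on finite ground set $E$ is a down-closed set of subsets of $E$. For sets $A,B$ write $A\prec B$ if $A\subseteq B$ and $|B\setminus A|=1$. A complete matching of $\mathcal{A}$ is a map $\mu:\mathcal{A}\to\mathcal{A}$ with $\mu\circ\mu=\mathrm{id}$ such that for every $F\in\mathcal{A}$, either $\mu(F)\prec F$ or $F\prec\mu(F)$. It is acyclic if there is no tuple $(B_1,\ldots,B_n)$ of distinct sets in $\mathcal{A}$ with $n\ge 2$, $\mu(B_i)\prec B_i$ for all $i\in\{1,\ldots,n\}$, $\mu(B_i)\prec B_{i+1}$ for all $i\in\{1,\ldots,n-1\}$, and $\mu(B_n)\prec B_1$. $\mathcal{A}$ is collapsible if it has an acyclic complete matching. -}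

module Defs where

open import Data.Nat using (ℕ; suc)
open import Data.Fin using (Fin; zero; suc; inject₁; fromℕ)
open import Data.Fin.Subset using (Subset; _∈_; _⊆_; _─_; ∣_∣)
open import Data.Product using (_×_; _,_; proj₁; proj₂; Σ; ∃)
open import Data.Sum using (_⊎_)
open import Relation.Binary.PropositionalEquality using (_≡_)
open import Relation.Nullary using (¬_)
open import Function.Definitions using (Injective)

-- A finite undirected multigraph with vertex set Fin n and edge set Fin m;
-- each edge has an (unordered) pair of endpoints, given as an ordered pair
-- (loops: both endpoints equal; parallel edges: equal endpoint pairs).
record Multigraph : Set where
  field
    nV   : ℕ
    nE   : ℕ
    ends : Fin nE → Fin nV × Fin nV
open Multigraph public

module _ (Γ : Multigraph) where

  Joins : Fin (nE Γ) → Fin (nV Γ) → Fin (nV Γ) → Set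
  Joins e x y = (proj₁ (ends Γ e) ≡ x × proj₂ (ends Γ e) ≡ y)
              ⊎ (proj₁ (ends Γ e) ≡ y × proj₂ (ends Γ e) ≡ x)

  data FPath (F : Subset (nE Γ)) : Fin (nV Γ) → Fin (nV Γ) → Set where
    here : ∀ {x} → FPath F x x
    step : ∀ {x y z} (e : Fin (nE Γ)) → e ∈ F → Joins e x y → FPath F y z → FPath F x z

  Infects : Fin (nV Γ) → Subset (nE Γ) → Fin (nE Γ) → Set
  Infects v F e = FPath F v (proj₁ (ends Γ e)) ⊎ FPath F v (proj₂ (ends Γ e))

  ⊆Shade : Fin (nV Γ) → Subset (nE Γ) → Subset (nE Γ) → Set
  ⊆Shade v G F = ∀ {e} → e ∈ G → Infects v F e

  𝒜 : Fin (nV Γ) → Subset (nE Γ) → Subset (nE Γ) → Set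
  𝒜 v G F = ¬ ⊆Shade v G F

_≺_ : ∀ {m} → Subset m → Subset m → Set
A ≺ B = A ⊆ B × ∣ B ─ A ∣ ≡ 1

module _ {m : ℕ} (𝓐 : Subset m → Set) where

  CompleteMatching : (Subset m → Subset m) → Set
  CompleteMatching μ = ∀ F → 𝓐 F →
    𝓐 (μ F) × μ (μ F) ≡ F × (μ F ≺ F ⊎ F ≺ μ F)

  Cycle : (Subset m → Subset m) → Set
  Cycle μ = Σ ℕ λ k → Σ (Fin (suc (suc k)) → Subset m) λ B →
      Injective _≡_ _≡_ B
    × (∀ i → 𝓐 (B i))
    × (∀ i → μ (B i) ≺ B i)
    × (∀ (i : Fin (suc k)) → μ (B (inject₁ i)) ≺ B (suc i))
    × (μ (B (fromℕ (suc k))) ≺ B zero)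

  Acyclic : (Subset m → Subset m) → Set
  Acyclic μ = ¬ Cycle μ

  Collapsible : Set
  Collapsible = ∃ λ μ → CompleteMatching μ × Acyclic μ

-- Membership in 𝒜 depends on F only through Shade F, and toggling an edge e
-- outside Shade F leaves Shade F unchanged: no F-path from v reaches an
-- endpoint of e, so adding or deleting e creates or destroys no such path.
-- Hence toggling the least edge outside Shade F (which exists, as Shade F ≠ E
-- on 𝒜) is an involution on 𝒜 that changes one element: a complete matching.
-- In a cycle, μ(Bᵢ) ⊆ Bᵢ₊₁ gives Shade Bᵢ = Shade μ(Bᵢ) ⊆ Shade Bᵢ₊₁, so all the
-- shades coincide and every Bᵢ is matched by removing the same edge e; then
-- μ(B₀) ≺ B₀ and μ(B₀) ≺ B₁ with e ∈ B₀, B₁ force B₀ = B₁.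
module Submission where

open import Defs
open import Data.Fin using (Fin)
open import Data.Fin.Subset using (Subset)

open import Data.Bool.Base using (not)
open import Data.Bool.Properties using (not-involutive)
open import Data.Fin.Base using (zero; suc; inject₁; fromℕ)
open import Data.Fin.Properties using (_≟_)
open import Data.Fin.Subset
  using (_∈_; _∉_; _⊆_; _⊂_; _─_; _-_; _∪_; ∣_∣; ⁅_⁆; ⊤; Nonempty; inside; outside)
open import Data.Fin.Subset.Properties
  using ( _∈?_; nonempty?; ∈⊤; x∈⁅x⁆; x∈⁅y⁆⇒x≡y; ∣⁅x⁆∣≡1; drop-there; drop-∷-⊆
        ; out⊆; s⊆s; ⊆-refl; ⊆-trans; ⊆-antisym; p⊂q⇒∣p∣<∣q∣
        ; x∈p∪q⁺; x∈p∪q⁻; x∈p∧x∉q⇒x∈p─q; x∈p∧x≢y⇒x∈p-y; x∈p⇒p-x⊂p )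
open import Data.Fin.Subset.Induction using (⊂-wellFounded)
open import Data.Nat.Base as ℕ using (ℕ; _<_)
open import Data.Nat.Properties using (<-irrefl)
open import Data.Product using (_×_; _,_; proj₁; proj₂; ∃; ∃₂)
open import Data.Sum using (_⊎_; inj₁; inj₂)
import Data.Sum as Sum
import Data.Vec.Base as Vec
open import Data.Vec.Base using (_∷_; []; updateAt; tabulate)
open import Data.Vec.Properties
  using ( updateAt-updates; updateAt-minimal; updateAt-updateAt-local
        ; updateAt-id-local; []=-injective; []=⇒lookup; lookup⇒[]=; lookup∘tabulate )
open import Function using (_∘_; id)
open import Induction.WellFounded using (Acc; acc)
open import Relation.Binary.Core using (Rel)
open import Relation.Binary.Definitions using (Reflexive; Transitive)
open import Relation.Binary.PropositionalEquality
  using (_≡_; _≢_; refl; sym; trans; cong; subst; subst₂; module ≡-Reasoning)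
open import Relation.Nullary using (¬_; Dec; yes; no; contradiction)
open import Relation.Nullary.Decidable
  using (does; map′; _⊎-dec_; _×-dec_; dec-true; dec-false; decidable-stable)
open import Relation.Unary using (Pred; Decidable)

private
  variable
    n : ℕ
    x y : Fin n
    A B C F S : Subset n

∣p∣≡1⇒∈-unique : ∣ S ∣ ≡ 1 → x ∈ S → y ∈ S → x ≡ y
∣p∣≡1⇒∈-unique {S = S} {x} {y} ∣S∣≡1 x∈S y∈S with x ≟ y
... | yes x≡y = x≡y
... | no x≢y = contradiction (subst₂ _<_ (∣⁅x⁆∣≡1 x) ∣S∣≡1 (p⊂q⇒∣p∣<∣q∣ ⁅x⁆⊂S)) (<-irrefl refl)
  where
  ⁅x⁆⊂S : ⁅ x ⁆ ⊂ S
  ⁅x⁆⊂S =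
    ( (λ z∈⁅x⁆ → subst (_∈ S) (sym (x∈⁅y⁆⇒x≡y x z∈⁅x⁆)) x∈S)
    , y , y∈S , x≢y ∘ sym ∘ x∈⁅y⁆⇒x≡y x )

≺-⊆ : A ≺ B → A ⊆ C → x ∈ B → x ∈ C → x ∉ A → B ⊆ C
≺-⊆ {A = A} {C = C} {x = x} (_ , ∣B─A∣≡1) A⊆C x∈B x∈C x∉A {z} z∈B with z ∈? A
... | yes z∈A = A⊆C z∈A
... | no z∉A = subst (_∈ C) (sym z≡x) x∈C
  where
  z≡x : z ≡ x
  z≡x = ∣p∣≡1⇒∈-unique ∣B─A∣≡1 (x∈p∧x∉q⇒x∈p─q z∈B z∉A) (x∈p∧x∉q⇒x∈p─q x∈B x∉A)

≺-unique : A ≺ B → A ≺ C → x ∈ B → x ∈ C → x ∉ A → B ≡ C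
≺-unique A≺B A≺C x∈B x∈C x∉A =
  ⊆-antisym (≺-⊆ A≺B (proj₁ A≺C) x∈B x∈C x∉A) (≺-⊆ A≺C (proj₁ A≺B) x∈C x∈B x∉A)

p⊆p-x∪⁅x⁆ : ∀ (p : Subset n) x → p ⊆ (p - x) ∪ ⁅ x ⁆
p⊆p-x∪⁅x⁆ p x {y} y∈p with y ≟ x
... | yes refl = x∈p∪q⁺ (inj₂ (x∈⁅x⁆ x))
... | no y≢x   = x∈p∪q⁺ (inj₁ (x∈p∧x≢y⇒x∈p-y y∈p y≢x))

∣p─p∣≡0 : ∀ (p : Subset n) → ∣ p ─ p ∣ ≡ 0
∣p─p∣≡0 []            = refl
∣p─p∣≡0 (inside ∷ p)  = ∣p─p∣≡0 p
∣p─p∣≡0 (outside ∷ p) = ∣p─p∣≡0 p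

∷-≺ : ∀ s → A ≺ B → (s ∷ A) ≺ (s ∷ B)
∷-≺ inside  (A⊆B , ∣B─A∣≡1) = s⊆s A⊆B , ∣B─A∣≡1
∷-≺ outside (A⊆B , ∣B─A∣≡1) = s⊆s A⊆B , ∣B─A∣≡1

toggle : Fin n → Subset n → Subset n
toggle e F = updateAt F e not

toggle-involutive : ∀ (e : Fin n) F → toggle e (toggle e F) ≡ F
toggle-involutive e F =
  trans (updateAt-updateAt-local e {h = id} F (not-involutive _)) (updateAt-id-local e F refl)

toggle-≺ : ∀ (e : Fin n) F → toggle e F ≺ F ⊎ F ≺ toggle e F
toggle-≺ zero    (inside ∷ F)  = inj₁ (out⊆ ⊆-refl , cong ℕ.suc (∣p─p∣≡0 F))
toggle-≺ zero    (outside ∷ F) = inj₂ (out⊆ ⊆-refl , cong ℕ.suc (∣p─p∣≡0 F))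
toggle-≺ (suc e) (s ∷ F)       = Sum.map (∷-≺ s) (∷-≺ s) (toggle-≺ e F)

∈-toggle-≢ : ∀ {e : Fin n} → x ≢ e → x ∈ toggle e F → x ∈ F
∈-toggle-≢ {x = x} {F = F} {e} x≢e x∈ =
  subst (x ∈_) (toggle-involutive e F) (updateAt-minimal x e (toggle e F) x≢e x∈)

toggle-⊆-∪⁅⁆ : ∀ (e : Fin n) → toggle e F ⊆ F ∪ ⁅ e ⁆
toggle-⊆-∪⁅⁆ e {x} x∈ with x ≟ e
... | yes refl = x∈p∪q⁺ (inj₂ (x∈⁅x⁆ x))
... | no x≢e   = x∈p∪q⁺ (inj₁ (∈-toggle-≢ x≢e x∈))

⊆-toggle-∪⁅⁆ : ∀ (e : Fin n) → F ⊆ toggle e F ∪ ⁅ e ⁆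
⊆-toggle-∪⁅⁆ {F = F} e x∈F =
  toggle-⊆-∪⁅⁆ e (subst (_ ∈_) (sym (toggle-involutive e F)) x∈F)

∉-toggle : ∀ {e : Fin n} → e ∈ F → e ∉ toggle e F
∉-toggle {F = F} {e} e∈F e∈toggle with []=-injective (updateAt-updates e F e∈F) e∈toggle
... | ()

toggle-⊆⇒∈ : ∀ (e : Fin n) F → toggle e F ⊆ F → e ∈ F
toggle-⊆⇒∈ zero    (inside ∷ F)  _   = Vec.here
toggle-⊆⇒∈ zero    (outside ∷ F) sub with sub Vec.here
... | ()
toggle-⊆⇒∈ (suc e) (_ ∷ F)       sub = Vec.there (toggle-⊆⇒∈ e F (drop-∷-⊆ sub))

toggleFirstOutside : Subset n → Subset n → Subset n
toggleFirstOutside []            []      = []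
toggleFirstOutside (outside ∷ S) (s ∷ F) = not s ∷ F
toggleFirstOutside (inside ∷ S)  (s ∷ F) = s ∷ toggleFirstOutside S F

toggleFirstOutside-spec : ∀ (S : Subset n) → S ≢ ⊤ →
  ∃ λ e → e ∉ S × ∀ F → toggleFirstOutside S F ≡ toggle e F
toggleFirstOutside-spec []            S≢⊤ = contradiction refl S≢⊤
toggleFirstOutside-spec (outside ∷ S) _   = zero , (λ ()) , λ { (_ ∷ _) → refl }
toggleFirstOutside-spec (inside ∷ S)  S≢⊤
  with toggleFirstOutside-spec S (S≢⊤ ∘ cong (inside ∷_))
... | e , e∉S , spec = suc e , e∉S ∘ drop-there , λ { (s ∷ F) → cong (s ∷_) (spec F) }

module _ {a ℓ} {A : Set a} {R : Rel A ℓ} (R-refl : Reflexive R) (R-trans : Transitive R) where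

  chain-first-last : ∀ {k} (f : Fin (ℕ.suc k) → A) →
    (∀ i → R (f (inject₁ i)) (f (suc i))) → R (f zero) (f (fromℕ k))
  chain-first-last {ℕ.zero}  f _        = R-refl
  chain-first-last {ℕ.suc k} f adjacent =
    R-trans (adjacent zero) (chain-first-last (f ∘ suc) (adjacent ∘ suc))

module ToggleMatching
  (S : Subset n → Subset n)
  (S-mono : ∀ {F F′} → F ⊆ F′ → S F ⊆ S F′)
  (S-toggle : ∀ {e F} → e ∉ S F → S (toggle e F) ≡ S F)
  (𝓐 : Subset n → Set)
  (𝓐⇒S≢⊤ : ∀ {F} → 𝓐 F → S F ≢ ⊤)
  (𝓐-resp-S : ∀ {F F′} → S F ≡ S F′ → 𝓐 F → 𝓐 F′)
  where

  -- The toggled element is chosen from S F alone, so μ (μ F) toggles it back.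
  μ : Subset n → Subset n
  μ F = toggleFirstOutside (S F) F

  μ≡toggle : 𝓐 F → ∃ λ e → e ∉ S F × ∀ {F′} → S F′ ≡ S F → μ F′ ≡ toggle e F′
  μ≡toggle {F} F∈𝓐 with toggleFirstOutside-spec (S F) (𝓐⇒S≢⊤ F∈𝓐)
  ... | e , e∉SF , spec = e , e∉SF , λ {F′} SF′≡SF →
    trans (cong (λ T → toggleFirstOutside T F′) SF′≡SF) (spec F′)

  S-μ : 𝓐 F → S (μ F) ≡ S F
  S-μ F∈𝓐 with μ≡toggle F∈𝓐
  ... | _ , e∉SF , μ≡ = trans (cong S (μ≡ refl)) (S-toggle e∉SF)

  μ-involutive : 𝓐 F → μ (μ F) ≡ F
  μ-involutive {F} F∈𝓐 with μ≡toggle F∈𝓐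
  ... | e , _ , μ≡ = begin
    μ (μ F)               ≡⟨ μ≡ (S-μ F∈𝓐) ⟩
    toggle e (μ F)        ≡⟨ cong (toggle e) (μ≡ refl) ⟩
    toggle e (toggle e F) ≡⟨ toggle-involutive e F ⟩
    F                     ∎
    where open ≡-Reasoning

  completeMatching : CompleteMatching 𝓐 μ
  completeMatching F F∈𝓐 with μ≡toggle F∈𝓐
  ... | e , _ , μ≡ =
    𝓐-resp-S (sym (S-μ F∈𝓐)) F∈𝓐 ,
    μ-involutive F∈𝓐 ,
    subst (λ M → M ≺ F ⊎ F ≺ M) (sym (μ≡ refl)) (toggle-≺ e F)

  S-mono-μ : 𝓐 A → μ A ⊆ B → S A ⊆ S B
  S-mono-μ {B = B} A∈𝓐 μA⊆B = subst (_⊆ S B) (S-μ A∈𝓐) (S-mono μA⊆B)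

  acyclic : Acyclic 𝓐 μ
  acyclic (k , B , B-injective , B∈𝓐 , down , mid , last) =
    contradiction (B-injective B₀≡B₁) λ ()
    where
    S-adjacent : ∀ i → S (B (inject₁ i)) ⊆ S (B (suc i))
    S-adjacent i = S-mono-μ (B∈𝓐 _) (proj₁ (mid i))

    S₀≡S₁ : S (B zero) ≡ S (B (suc zero))
    S₀≡S₁ = ⊆-antisym (S-adjacent zero)
      (⊆-trans (chain-first-last {R = _⊆_} ⊆-refl ⊆-trans (S ∘ B ∘ suc) (S-adjacent ∘ suc))
               (S-mono-μ (B∈𝓐 _) (proj₁ last)))

    B₀≡B₁ : B zero ≡ B (suc zero)
    B₀≡B₁ with μ≡toggle (B∈𝓐 zero)
    ... | e , _ , μ≡ = ≺-unique (down zero) (mid zero) e∈B₀ e∈B₁ e∉μB₀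
      where
      e∈B₀ : e ∈ B zero
      e∈B₀ = toggle-⊆⇒∈ e _ (subst (_⊆ B zero) (μ≡ refl) (proj₁ (down zero)))
      e∈B₁ : e ∈ B (suc zero)
      e∈B₁ = toggle-⊆⇒∈ e _
        (subst (_⊆ B (suc zero)) (μ≡ (sym S₀≡S₁)) (proj₁ (down (suc zero))))
      e∉μB₀ : e ∉ μ (B zero)
      e∉μB₀ = ∉-toggle e∈B₀ ∘ subst (e ∈_) (μ≡ refl)

  collapsible : Collapsible 𝓐
  collapsible = μ , completeMatching , acyclic

module _ {p} {P : Pred (Fin n) p} (P? : Decidable P) where

  toSubset : Subset n
  toSubset = tabulate (does ∘ P?)

  ∈-toSubset⁺ : P x → x ∈ toSubset
  ∈-toSubset⁺ {x} Px = lookup⇒[]= x toSubset (trans (lookup∘tabulate _ x) (dec-true (P? x) Px))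

  ∈-toSubset⁻ : x ∈ toSubset → P x
  ∈-toSubset⁻ {x} x∈ = decidable-stable (P? x) λ ¬Px →
    contradiction
      (trans (sym ([]=⇒lookup x∈)) (trans (lookup∘tabulate _ x) (dec-false (P? x) ¬Px)))
      λ ()

module _ (Γ : Multigraph) where

  private
    variable
      u w p q : Fin (nV Γ)
      e : Fin (nE Γ)
      D D′ : Subset (nE Γ)

    src tgt : Fin (nE Γ) → Fin (nV Γ)
    src e = proj₁ (ends Γ e)
    tgt e = proj₂ (ends Γ e)

  FPath-mono : D ⊆ D′ → FPath Γ D u w → FPath Γ D′ u w
  FPath-mono _   here             = here
  FPath-mono sub (step e e∈D J P) = step e (sub e∈D) J (FPath-mono sub P)

  FPath-++ : FPath Γ D u p → FPath Γ D p w → FPath Γ D u w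
  FPath-++ here             Q = Q
  FPath-++ (step e e∈D J P) Q = step e e∈D J (FPath-++ P Q)

  FPath-edgeless : ¬ Nonempty D → FPath Γ D u w → u ≡ w
  FPath-edgeless _       here            = refl
  FPath-edgeless D-empty (step e e∈D _ _) = contradiction (e , e∈D) D-empty

  Joins-reanchor : Joins Γ e u w → Joins Γ e p q → q ≢ u → Joins Γ e u q
  Joins-reanchor (inj₁ (s≡u , _)) (inj₁ (_ , t≡q)) _   = inj₁ (s≡u , t≡q)
  Joins-reanchor (inj₁ (s≡u , _)) (inj₂ (s≡q , _)) q≢u = contradiction (trans (sym s≡q) s≡u) q≢u
  Joins-reanchor (inj₂ (_ , t≡u)) (inj₁ (_ , t≡q)) q≢u = contradiction (trans (sym t≡q) t≡u) q≢u
  Joins-reanchor (inj₂ (_ , t≡u)) (inj₂ (s≡q , _)) _   = inj₂ (s≡q , t≡u)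

  Via : Subset (nE Γ) → Fin (nE Γ) → Fin (nV Γ) → Fin (nV Γ) → Set
  Via D e u w = ∃₂ λ p q → Joins Γ e p q × FPath Γ D u p × FPath Γ D q w

  FPath-avoid-or-via : D ⊆ D′ ∪ ⁅ e ⁆ → FPath Γ D u w → FPath Γ D′ u w ⊎ Via D′ e u w
  FPath-avoid-or-via sub here = inj₁ here
  FPath-avoid-or-via {D′ = D′} {e} {u} sub (step e′ e′∈D J P)
    with Sum.map₂ (x∈⁅y⁆⇒x≡y e) (x∈p∪q⁻ D′ ⁅ e ⁆ (sub e′∈D)) | FPath-avoid-or-via sub P
  ... | inj₁ e′∈D′ | inj₁ Q                     = inj₁ (step e′ e′∈D′ J Q)
  ... | inj₁ e′∈D′ | inj₂ (p , q , K , Q₁ , Q₂) = inj₂ (p , q , K , step e′ e′∈D′ J Q₁ , Q₂)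
  ... | inj₂ refl  | inj₁ Q                     = inj₂ (u , _ , J , here , Q)
  -- A later crossing p–q of e either returns to u, and the loop is cut out, or e joins u to q.
  ... | inj₂ refl  | inj₂ (p , q , K , Q₁ , Q₂) with q ≟ u
  ...   | yes refl = inj₁ Q₂
  ...   | no q≢u   = inj₂ (u , q , Joins-reanchor J K q≢u , here , Q₂)

  FPath?-acc : ∀ D → Acc _⊂_ D → ∀ u w → Dec (FPath Γ D u w)
  FPath?-acc D (acc smaller) u w with nonempty? D
  ... | no D-empty = map′ (λ { refl → here }) (FPath-edgeless D-empty) (u ≟ w)
  ... | yes (e , e∈D) =
    map′ fromCases toCases (D-e? u w ⊎-dec (D-e? u (src e) ×-dec D-e? (tgt e) w
                                         ⊎-dec D-e? u (tgt e) ×-dec D-e? (src e) w))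
    where
    D-e : Subset (nE Γ)
    D-e = D - e
    D-e⊆D : D-e ⊆ D
    D-e⊆D = proj₁ (x∈p⇒p-x⊂p e∈D)
    D-e? : ∀ u w → Dec (FPath Γ D-e u w)
    D-e? = FPath?-acc D-e (smaller (x∈p⇒p-x⊂p e∈D))
    Cases : Set
    Cases = FPath Γ D-e u w ⊎ (FPath Γ D-e u (src e) × FPath Γ D-e (tgt e) w
                             ⊎ FPath Γ D-e u (tgt e) × FPath Γ D-e (src e) w)

    fromCases : Cases → FPath Γ D u w
    fromCases (inj₁ P) = FPath-mono D-e⊆D P
    fromCases (inj₂ (inj₁ (P , Q))) =
      FPath-++ (FPath-mono D-e⊆D P) (step e e∈D (inj₁ (refl , refl)) (FPath-mono D-e⊆D Q))
    fromCases (inj₂ (inj₂ (P , Q))) =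
      FPath-++ (FPath-mono D-e⊆D P) (step e e∈D (inj₂ (refl , refl)) (FPath-mono D-e⊆D Q))

    toCases : FPath Γ D u w → Cases
    toCases P with FPath-avoid-or-via (p⊆p-x∪⁅x⁆ D e) P
    ... | inj₁ Q                                      = inj₁ Q
    ... | inj₂ (_ , _ , inj₁ (refl , refl) , Q₁ , Q₂) = inj₂ (inj₁ (Q₁ , Q₂))
    ... | inj₂ (_ , _ , inj₂ (refl , refl) , Q₁ , Q₂) = inj₂ (inj₂ (Q₁ , Q₂))

  FPath? : ∀ D u w → Dec (FPath Γ D u w)
  FPath? D = FPath?-acc D (⊂-wellFounded D)

  module _ (v : Fin (nV Γ)) where

    Infects? : ∀ D → Decidable (Infects Γ v D)
    Infects? D e = FPath? D v (src e) ⊎-dec FPath? D v (tgt e)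

    shade : Subset (nE Γ) → Subset (nE Γ)
    shade D = toSubset (Infects? D)

    ∈-shade⁺ : Infects Γ v D e → e ∈ shade D
    ∈-shade⁺ = ∈-toSubset⁺ (Infects? _)

    ∈-shade⁻ : e ∈ shade D → Infects Γ v D e
    ∈-shade⁻ = ∈-toSubset⁻ (Infects? _)

    Joins⇒Infects : Joins Γ e p q → FPath Γ D v p → Infects Γ v D e
    Joins⇒Infects (inj₁ (s≡p , _)) P = inj₁ (subst (FPath Γ _ v) (sym s≡p) P)
    Joins⇒Infects (inj₂ (_ , t≡p)) P = inj₂ (subst (FPath Γ _ v) (sym t≡p) P)

    FPath-⊆∪-uninfected : D′ ⊆ D ∪ ⁅ e ⁆ → ¬ Infects Γ v D e → FPath Γ D′ v u → FPath Γ D v u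
    FPath-⊆∪-uninfected D′⊆ ¬infected P with FPath-avoid-or-via D′⊆ P
    ... | inj₁ Q                    = Q
    ... | inj₂ (_ , _ , J , Q₁ , _) = contradiction (Joins⇒Infects J Q₁) ¬infected

    shade-mono : D ⊆ D′ → shade D ⊆ shade D′
    shade-mono D⊆D′ =
      ∈-shade⁺ ∘ Sum.map (FPath-mono D⊆D′) (FPath-mono D⊆D′) ∘ ∈-shade⁻

    shade-⊆∪-uninfected : D′ ⊆ D ∪ ⁅ e ⁆ → e ∉ shade D → shade D′ ⊆ shade D
    shade-⊆∪-uninfected D′⊆ e∉ = ∈-shade⁺ ∘ Sum.map reach reach ∘ ∈-shade⁻
      where
      reach : FPath Γ _ v u → FPath Γ _ v u
      reach = FPath-⊆∪-uninfected D′⊆ (e∉ ∘ ∈-shade⁺)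

    shade-toggle : e ∉ shade D → shade (toggle e D) ≡ shade D
    shade-toggle {e} {D} e∉ = ⊆-antisym shade-toggle⊆shade
      (shade-⊆∪-uninfected (⊆-toggle-∪⁅⁆ e) (e∉ ∘ shade-toggle⊆shade))
      where
      shade-toggle⊆shade : shade (toggle e D) ⊆ shade D
      shade-toggle⊆shade = shade-⊆∪-uninfected (toggle-⊆-∪⁅⁆ e) e∉

    module _ (G : Subset (nE Γ)) where

      𝒜⇒shade≢⊤ : 𝒜 Γ v G D → shade D ≢ ⊤
      𝒜⇒shade≢⊤ D∈𝒜 shade≡⊤ = D∈𝒜 λ _ → ∈-shade⁻ (subst (_ ∈_) (sym shade≡⊤) ∈⊤)

      𝒜-resp-shade : shade D ≡ shade D′ → 𝒜 Γ v G D → 𝒜 Γ v G D′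
      𝒜-resp-shade shade≡ D∈𝒜 G⊆Shade =
        D∈𝒜 (∈-shade⁻ ∘ subst (_ ∈_) (sym shade≡) ∘ ∈-shade⁺ ∘ G⊆Shade)

theorem5p5 : (Γ : Multigraph) (v : Fin (nV Γ)) (G : Subset (nE Γ)) →
    Collapsible (𝒜 Γ v G)
theorem5p5 Γ v G = collapsible
  where
  open ToggleMatching (shade Γ v) (shade-mono Γ v) (shade-toggle Γ v)
    (𝒜 Γ v G) (𝒜⇒shade≢⊤ Γ v G) (𝒜-resp-shade Γ v G)
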